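{- The relation $\sqsupset$ is well-founded on the set of all terms: there is no infinite sequence of terms $s_0 \sqsupset s_1 \sqsupset s_2 \sqsupset \cdots$.
   Context: Simply typed terms: there is a single base type (sort) $\iota$; types are $\iota$ and $\sigma \Rightarrow \tau$. Given a set of typed variables (infinitely many of each type) and a possibly infinite set of typed function symbols, terms are built from variables and function symbols by type-respecting application: if $s :: \sigma \Rightarrow \tau$ and $t :: \sigma$ then $s\ t :: \tau$ (left-associative). Every term has the form $a\ s_1 \cdots s_n$ ($n\ge 0$) with $a$ a variable or function symbol. Fixed data: a precedence $\unrhd$ (a quasi-ordering on function symbols whose strict part $\rhd$ is well-founded; $\equiv$ denotes $\unrhd \cap \unlhd$), and a filter $\pi$ assigning to each $\mathsf{f} :: \sigma_1 \Rightarrow \dots \Rightarrow \sigma_m \Rightarrow \iota$ a set $\pi(\mathsf{f}) \subseteq \{1,\dots,m\}$; for each $\mathsf{f}$ the arities of the symbols $\mathsf{g} \equiv \mathsf{f}$ are bounded. Equivalence: $s \approx t$ iff $s,t$ have the same type and either (Eq-mono) $s = x\ s_1 \cdots s_n$, $t = x\ t_1 \cdots t_n$, $x$ a variable, $s_i \approx t_i$ for all $i$; or (Eq-args) $s = \mathsf{f}\ s_1 \cdots s_n$, $t = \mathsf{g}\ t_1 \cdots t_n$, $\mathsf{f},\mathsf{g}$ function symbols of the same type, $\mathsf{f} \equiv \mathsf{g}$, $\pi(\mathsf{f}) = \pi(\mathsf{g})$, $s_i \approx t_i$ for all $i \in \pi(\mathsf{f}) \cap \{1,\dots,n\}$. The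 relations $\sqsupseteq, \sqsupset, \sqsupset\!\!\sqsupset$ are the least relations such that: $s \sqsupseteq t$ iff $s \approx t$ or $s \sqsupset t$. $s \sqsupset t$ if $s,t$ have the same type and one of: (Gr-mono) $s = x\ s_1 \cdots s_n$, $t = x\ t_1 \cdots t_n$, $x$ a variable, $s_i \sqsupseteq t_i$ for all $i$ and $s_i \sqsupset t_i$ for some $i$; (Gr-args) $s = \mathsf{f}\ s_1 \cdots s_n$, $t = \mathsf{g}\ t_1 \cdots t_n$, $\mathsf{f},\mathsf{g}$ of the same type, $\mathsf{f} \equiv \mathsf{g}$, $\pi(\mathsf{f}) = \pi(\mathsf{g})$, $s_i \sqsupseteq t_i$ for all $i \in \pi(\mathsf{f}) \cap \{1,\dots,n\}$ and $s_i \sqsupset t_i$ for some such $i$; (Gr-rpo) $s \sqsupset\!\!\sqsupset t$. $s \sqsupset\!\!\sqsupset t$ ($s,t$ possibly of different types) if $s = \mathsf{f}\ s_1 \cdots s_n$ with $\mathsf{f} :: \sigma_1 \Rightarrow \dots \Rightarrow \sigma_m \Rightarrow \iota$, $\{n+1,\dots,m\} \subseteq \pi(\mathsf{f})$, and one of: (Rpo-select) $s_i \sqsupseteq t$ for some $i \in \pi(\mathsf{f}) \cap \{1,\dots,n\}$; (Rpo-appl) $t = t_0\ t_1 \cdots t_k$ with $k \ge 1$ and $s \sqsupset\!\!\sqsupset t_i$ for all $0 \le i \le k$; (Rpo-copy) $t = \mathsf{g}\ t_1 \cdots t_k$ with $\mathsf{f} \rhd \mathsf{g}$ and $s \sqsupset\!\!\sqsupset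 t_i$ for all $i \in \pi(\mathsf{g}) \cap \{1,\dots,k\}$; (Rpo-lex) $t = \mathsf{g}\ t_1 \cdots t_k$ with $\mathsf{f} \equiv \mathsf{g}$ and there is $i \in \pi(\mathsf{f}) \cap \pi(\mathsf{g}) \cap \{1,\dots,\min(n,k)\}$ with $\pi(\mathsf{f}) \cap \{1,\dots,i\} = \pi(\mathsf{g}) \cap \{1,\dots,i\}$, $s_j \approx t_j$ for all $j \in \{1,\dots,i-1\} \cap \pi(\mathsf{f})$, $s_i \sqsupset t_i$, and $s \sqsupset\!\!\sqsupset t_j$ for all $j \in \{i+1,\dots,k\} \cap \pi(\mathsf{g})$. -}

module Defs where

open import Data.Nat using (ℕ; zero; suc; _≤_; _<_; _⊔_)
open import Data.Nat.Properties using ()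
open import Data.Bool using (Bool; T)
open import Data.List using (List; []; _∷_; _++_; [_]; length)
open import Data.List.Relation.Unary.All using (All)
open import Data.Product using (Σ; ∃; ∃-syntax; _×_; _,_)
open import Data.Sum using (_⊎_)
open import Relation.Nullary using (¬_)
open import Relation.Binary.PropositionalEquality using (_≡_)

infixr 5 _⇒_
data Ty : Set where
  ι   : Ty
  _⇒_ : Ty → Ty → Ty

arity : Ty → ℕ
arity ι       = 0
arity (σ ⇒ τ) = suc (arity τ)

-- Indexing into lists, 1-based: At xs i x  iff  x is the i-th element.

data At {A : Set} : List A → ℕ → A → Set where
  here  : ∀ {x xs} → At (x ∷ xs) 1 x
  there : ∀ {y x xs i} → At xs i x → At (y ∷ xs) (suc i) x

-- Everything below is relative to a (possibly infinite) type Sym of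
-- function symbols with their types, a precedence ⊵ and a filter π
-- (π f i = true  means  i ∈ π(f), positions 1-based).

module RPO (Sym : Set) (typ : Sym → Ty)
           (_⊵_ : Sym → Sym → Set) (π : Sym → ℕ → Bool) where

  -- Terms in spine form  a s₁ ⋯ sₙ,  a a variable or a function symbol.
  -- The variables of type σ are  var σ x  for x : ℕ (infinitely many per type).
  data Tm : Set where
    var : Ty → ℕ → List Tm → Tm
    fun : Sym → List Tm → Tm

  mutual
    data WT : Tm → Ty → Set where
      var : ∀ {σ τ x ss} → WTArgs σ ss τ → WT (var σ x ss) τ
      fun : ∀ {f τ ss} → WTArgs (typ f) ss τ → WT (fun f ss) τ

    data WTArgs : Ty → List Tm → Ty → Set where
      []  : ∀ {σ} → WTArgs σ [] σ
      _∷_ : ∀ {σ τ ρ s ss} → WT s σ → WTArgs τ ss ρ → WTArgs (σ ⇒ τ) (s ∷ ss) ρ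

  Term : Set
  Term = Σ Tm λ s → Σ Ty λ σ → WT s σ

  SameTy : Tm → Tm → Set
  SameTy s t = Σ Ty λ σ → WT s σ × WT t σ

  app : Tm → Tm → Tm
  app (var σ x ss) u = var σ x (ss ++ [ u ])
  app (fun f ss)   u = fun f (ss ++ [ u ])

  apps : Tm → List Tm → Tm
  apps t []       = t
  apps t (u ∷ us) = apps (app t u) us

  _≃ₚ_ : Sym → Sym → Set
  f ≃ₚ g = f ⊵ g × g ⊵ f

  _▷_ : Sym → Sym → Set
  f ▷ g = f ⊵ g × ¬ (g ⊵ f)

  _∈π_ : ℕ → Sym → Set
  i ∈π f = T (π f i)

  SameFilter : Sym → Sym → Set
  SameFilter f g = ∀ i → π f i ≡ π g i

  Closed : Sym → ℕ → Set
  Closed f n = ∀ i → n < i → i ≤ arity (typ f) → i ∈π f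

  data _≈_ : Tm → Tm → Set where
    eq-mono : ∀ {σ x ss ts} → length ss ≡ length ts →
              (∀ i a b → At ss i a → At ts i b → a ≈ b) →
              var σ x ss ≈ var σ x ts
    eq-args : ∀ {f g ss ts} → typ f ≡ typ g → f ≃ₚ g → SameFilter f g →
              length ss ≡ length ts →
              (∀ i a b → i ∈π f → At ss i a → At ts i b → a ≈ b) →
              fun f ss ≈ fun g ts

  mutual
    data _⊒_ : Tm → Tm → Set where
      ≈⇒⊒ : ∀ {s t} → s ≈ t → s ⊒ t
      ⊐⇒⊒ : ∀ {s t} → s ⊐ t → s ⊒ t

    data _⊐_ : Tm → Tm → Set where
      gr-mono : ∀ {σ x ss ts} → length ss ≡ length ts →
                (∀ i a b → At ss i a → At ts i b → a ⊒ b) →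
                (∃[ i ] ∃[ a ] ∃[ b ] (At ss i a × At ts i b × a ⊐ b)) →
                var σ x ss ⊐ var σ x ts
      gr-args : ∀ {f g ss ts} → typ f ≡ typ g → f ≃ₚ g → SameFilter f g →
                length ss ≡ length ts →
                (∀ i a b → i ∈π f → At ss i a → At ts i b → a ⊒ b) →
                (∃[ i ] ∃[ a ] ∃[ b ] (i ∈π f × At ss i a × At ts i b × a ⊐ b)) →
                fun f ss ⊐ fun g ts
      gr-rpo  : ∀ {s t} → SameTy s t → s ⊐⊐ t → s ⊐ t

    data _⊐⊐_ : Tm → Tm → Set where
      rpo-select : ∀ {f ss t} → Closed f (length ss) →
                   (∃[ i ] ∃[ a ] (i ∈π f × At ss i a × a ⊒ t)) →
                   fun f ss ⊐⊐ t
      rpo-appl   : ∀ {f ss t} → Closed f (length ss) →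
                   (t₀ u : Tm) (us : List Tm) → t ≡ apps t₀ (u ∷ us) →
                   fun f ss ⊐⊐ t₀ → All (λ v → fun f ss ⊐⊐ v) (u ∷ us) →
                   fun f ss ⊐⊐ t
      rpo-copy   : ∀ {f ss g ts} → Closed f (length ss) → f ▷ g →
                   (∀ i b → i ∈π g → At ts i b → fun f ss ⊐⊐ b) →
                   fun f ss ⊐⊐ fun g ts
      rpo-lex    : ∀ {f ss g ts} → Closed f (length ss) → f ≃ₚ g →
                   (i : ℕ) (a b : Tm) → i ∈π f → i ∈π g →
                   At ss i a → At ts i b →
                   (∀ j → j ≤ i → π f j ≡ π g j) →
                   (∀ j a' b' → j < i → j ∈π f → At ss j a' → At ts j b' → a' ≈ b') →
                   a ⊐ b →
                   (∀ j b' → i < j → j ∈π g → At ts j b' → fun f ss ⊐⊐ b') →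
                   fun f ss ⊐⊐ fun g ts

  InfiniteDescent : Set
  InfiniteDescent = Σ (ℕ → Tm) λ s →
    (∀ n → ∃[ σ ] WT (s n) σ) × (∀ n → s n ⊐ s (suc n))

{-# OPTIONS --safe #-}
-- Tait's computability method. A well-typed term of base type is computable if it is accessible
-- for ⊐ on well-typed terms, and one of type σ ⇒ τ if it maps computable arguments to computable
-- applications. Computable terms are accessible (apply them to a variable), and computability is
-- preserved by ⊒ because ⊐ is monotone in the function part of an application; for Rpo-steps this
-- is where the condition {n+1,…,m} ⊆ π(f) is needed. It remains to show that every well-typed term
-- is computable. An applied variable with accessible arguments is accessible by lexicographic
-- induction on its arguments. For f s₁ ⋯ sₙ with computable filtered arguments one inducts on the
-- precedence of f and, within the ≃-class of f, on the filtered arguments compared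
-- lexicographically modulo ≈ as vectors of the arity bound of that class: a Gr-args step lowers
-- the arguments, and every Rpo-step builds the smaller term from computable pieces (a filtered
-- argument, applications, or a symbol that is lower in the precedence, or equivalent with
-- lexicographically smaller arguments).
module Submission where

open import Defs
open import Data.Bool using (Bool; true; false; T)
open import Data.Empty using (⊥)
open import Data.List using (List; []; _∷_; _++_; [_]; length)
open import Data.List.Properties using (length-++)
open import Data.List.Relation.Unary.All using (All; []; _∷_)
open import Data.Nat using (ℕ; zero; suc; _≤_; _<_; z≤n; s≤s)
open import Data.Nat.Properties using (≤-refl; ≤-trans; <⇒≤; n≤1+n; +-comm; suc-injective; <-cmp)
open import Data.Product using (Σ; ∃; ∃-syntax; _×_; _,_; proj₁; proj₂; map₂; swap)
open import Data.Sum using (_⊎_; inj₁; inj₂)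
import Data.Sum as Sum
open import Data.Unit using (⊤; tt)
open import Data.Vec using (Vec; []; _∷_)
open import Data.Vec.Relation.Binary.Lex.Strict using (Lex-<; <-wellFounded; this; next)
open import Function using (_∘_; _on_; flip; const)
open import Induction.WellFounded using (WellFounded; Acc; acc)
open import Relation.Binary.Definitions using (_Respectsʳ_; tri<; tri≈; tri>)
open import Relation.Binary.PropositionalEquality using (_≡_; refl; sym; trans; cong; subst)
open import Relation.Binary.Structures using (IsPreorder)
open import Relation.Nullary using (¬_)

module _ {A : Set} where
  private variable
    xs ys : List A
    x y a b : A
    i : ℕ

  At-unique : At xs i a → At xs i b → a ≡ b
  At-unique here      here      = refl
  At-unique (there p) (there q) = At-unique p q

  At-positive : At xs i a → 1 ≤ i
  At-positive here      = s≤s z≤n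
  At-positive (there _) = s≤s z≤n

  At-length : At xs i a → i ≤ length xs
  At-length here      = s≤s z≤n
  At-length (there p) = s≤s (At-length p)

  At-transport : i ≤ length ys → At xs i a → ∃ (At ys i)
  At-transport {ys = y ∷ _} _         here      = y , here
  At-transport {ys = _ ∷ _} (s≤s i≤n) (there p) = map₂ there (At-transport i≤n p)

  At-align : length xs ≡ length ys → At xs i a → ∃ (At ys i)
  At-align eq p = At-transport (subst (_ ≤_) eq (At-length p)) p

  At-++⁺ˡ : At xs i a → At (xs ++ ys) i a
  At-++⁺ˡ here      = here
  At-++⁺ˡ (there p) = there (At-++⁺ˡ p)

  At-++⁻ˡ : ∀ xs → At (xs ++ ys) i a → i ≤ length xs → At xs i a
  At-++⁻ˡ []       here      ()
  At-++⁻ˡ []       (there _) ()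
  At-++⁻ˡ (_ ∷ _)  here      _         = here
  At-++⁻ˡ (_ ∷ xs) (there p) (s≤s i≤n) = there (At-++⁻ˡ xs p i≤n)

  length-∷ʳ : ∀ xs → length (xs ++ [ x ]) ≡ suc (length xs)
  length-∷ʳ xs = trans (length-++ xs) (+-comm (length xs) 1)

  length-∷ʳ-cong : ∀ xs ys → length xs ≡ length ys → length (xs ++ [ x ]) ≡ length (ys ++ [ y ])
  length-∷ʳ-cong xs ys eq = trans (length-∷ʳ xs) (trans (cong suc eq) (sym (length-∷ʳ ys)))

  At-∷ʳ-last : ∀ xs → At (xs ++ [ x ]) (suc (length xs)) x
  At-∷ʳ-last []       = here
  At-∷ʳ-last (_ ∷ xs) = there (At-∷ʳ-last xs)

  At-∷ʳ⁻ : ∀ xs → At (xs ++ [ x ]) i a → At xs i a ⊎ a ≡ x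
  At-∷ʳ⁻ []       here      = inj₂ refl
  At-∷ʳ⁻ (_ ∷ _)  here      = inj₁ here
  At-∷ʳ⁻ (_ ∷ xs) (there p) = Sum.map₁ there (At-∷ʳ⁻ xs p)

  At-∷ʳ-elim : {R : A → A → Set} → length xs ≡ length ys →
               (∀ {a b} → At xs i a → At ys i b → R a b) → R x y →
               At (xs ++ [ x ]) i a → At (ys ++ [ y ]) i b → R a b
  At-∷ʳ-elim {xs = []}    {ys = []}    _  _ r here      here      = r
  At-∷ʳ-elim {xs = _ ∷ _} {ys = _ ∷ _} _  h _ here      here      = h here here
  At-∷ʳ-elim {xs = _ ∷ _} {ys = _ ∷ _} eq h r (there p) (there q) =
    At-∷ʳ-elim (suc-injective eq) (λ p q → h (there p) (there q)) r p q

module Termination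
  (Sym : Set) (typ : Sym → Ty) (_⊵_ : Sym → Sym → Set) (π : Sym → ℕ → Bool)
  (⊵-isPreorder : IsPreorder _≡_ _⊵_)
  (▷-wellFounded : WellFounded (λ g f → RPO._▷_ Sym typ _⊵_ π f g))
  (≃ₚ-arity-bounded : ∀ f → ∃[ B ] (∀ g → RPO._≃ₚ_ Sym typ _⊵_ π g f → arity (typ g) ≤ B))
  where

  open RPO Sym typ _⊵_ π
  open IsPreorder ⊵-isPreorder using () renaming (refl to ⊵-refl; trans to ⊵-trans)

  private variable
    σ τ ρ : Ty
    s t u a b : Tm
    ss ts us : List Tm
    f g h : Sym
    i : ℕ

  ≃ₚ-refl : f ≃ₚ f
  ≃ₚ-refl = ⊵-refl , ⊵-refl

  ≃ₚ-sym : f ≃ₚ g → g ≃ₚ f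
  ≃ₚ-sym = swap

  ≃ₚ-trans : f ≃ₚ g → g ≃ₚ h → f ≃ₚ h
  ≃ₚ-trans (f⊵g , g⊵f) (g⊵h , h⊵g) = ⊵-trans f⊵g g⊵h , ⊵-trans h⊵g g⊵f

  ≃ₚ-▷-trans : f ≃ₚ g → g ▷ h → f ▷ h
  ≃ₚ-▷-trans (f⊵g , _) (g⊵h , h⋭g) = ⊵-trans f⊵g g⊵h , λ h⊵f → h⋭g (⊵-trans h⊵f f⊵g)

  WTArgs-unique : WTArgs σ ss τ → WTArgs σ ts ρ → length ss ≡ length ts → τ ≡ ρ
  WTArgs-unique []       []        _  = refl
  WTArgs-unique (_ ∷ ws) (_ ∷ ws′) eq = WTArgs-unique ws ws′ (suc-injective eq)

  WT-unique : WT s σ → WT s τ → σ ≡ τ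
  WT-unique (var ws) (var ws′) = WTArgs-unique ws ws′ refl
  WT-unique (fun ws) (fun ws′) = WTArgs-unique ws ws′ refl

  WT-fun-unique : typ f ≡ typ g → length ss ≡ length ts → WT (fun f ss) σ → WT (fun g ts) τ → σ ≡ τ
  WT-fun-unique {ts = ts} {τ = τ} eq len (fun ws) (fun wt) =
    WTArgs-unique ws (subst (λ σ → WTArgs σ ts τ) (sym eq) wt) len

  WTArgs-At : WTArgs σ ss τ → At ss i a → ∃ (WT a)
  WTArgs-At (w ∷ _)  here      = _ , w
  WTArgs-At (_ ∷ ws) (there p) = WTArgs-At ws p

  WT-fun-At : WT (fun f ss) τ → At ss i a → ∃ (WT a)
  WT-fun-At (fun ws) = WTArgs-At ws

  WTArgs-length : WTArgs σ ss τ → length ss ≤ arity σ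
  WTArgs-length []       = z≤n
  WTArgs-length (_ ∷ ws) = s≤s (WTArgs-length ws)

  WTArgs-∷ʳ : WTArgs σ ss (ρ ⇒ τ) → WT u ρ → WTArgs σ (ss ++ [ u ]) τ
  WTArgs-∷ʳ []       wu = wu ∷ []
  WTArgs-∷ʳ (w ∷ ws) wu = w ∷ WTArgs-∷ʳ ws wu

  WTArgs-∷ʳ⁻ : ∀ ss → WTArgs σ (ss ++ [ u ]) τ → ∃[ ρ ] WTArgs σ ss (ρ ⇒ τ) × WT u ρ
  WTArgs-∷ʳ⁻ []       (wu ∷ []) = _ , [] , wu
  WTArgs-∷ʳ⁻ (_ ∷ ss) (w ∷ ws)  = let ρ , ws′ , wu = WTArgs-∷ʳ⁻ ss ws in ρ , w ∷ ws′ , wu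

  WT-app : WT s (ρ ⇒ τ) → WT u ρ → WT (app s u) τ
  WT-app (var ws) wu = var (WTArgs-∷ʳ ws wu)
  WT-app (fun ws) wu = fun (WTArgs-∷ʳ ws wu)

  WT-app⁻ : ∀ s → WT (app s u) τ → ∃[ ρ ] WT s (ρ ⇒ τ) × WT u ρ
  WT-app⁻ (var σ x ss) (var ws) = let ρ , ws′ , wu = WTArgs-∷ʳ⁻ ss ws in ρ , var ws′ , wu
  WT-app⁻ (fun f ss)   (fun ws) = let ρ , ws′ , wu = WTArgs-∷ʳ⁻ ss ws in ρ , fun ws′ , wu

  WT-apps⁻ : ∀ t us → WT (apps t us) τ → ∃[ σ ] WT t σ × WTArgs σ us τ
  WT-apps⁻ t []       wt = _ , wt , []
  WT-apps⁻ t (u ∷ us) wt =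
    let _ , wtu , wus = WT-apps⁻ (app t u) us wt
        ρ , wt′ , wu  = WT-app⁻ t wtu
    in ρ ⇒ _ , wt′ , wu ∷ wus

  ≈-type : s ≈ t → WT s σ → WT t τ → σ ≡ τ
  ≈-type (eq-mono len _)       (var ws) (var wt) = WTArgs-unique ws wt len
  ≈-type (eq-args eq _ _ len _) ws       wt       = WT-fun-unique eq len ws wt

  ⊐-type : s ⊐ t → WT s σ → WT t τ → σ ≡ τ
  ⊐-type (gr-mono len _ _)         (var ws) (var wt) = WTArgs-unique ws wt len
  ⊐-type (gr-args eq _ _ len _ _)  ws       wt       = WT-fun-unique eq len ws wt
  ⊐-type (gr-rpo (_ , ws′ , wt′) _) ws      wt       = trans (WT-unique ws ws′) (WT-unique wt′ wt)

  ⊒-type : s ⊒ t → WT s σ → WT t τ → σ ≡ τ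
  ⊒-type (≈⇒⊒ s≈t) = ≈-type s≈t
  ⊒-type (⊐⇒⊒ s⊐t) = ⊐-type s⊐t

  mutual
    ≈-refl : ∀ s → s ≈ s
    ≈-refl (var σ x ss) = eq-mono refl (λ _ _ _ → At-≈-refl ss)
    ≈-refl (fun f ss)   = eq-args refl ≃ₚ-refl (λ _ → refl) refl (λ _ _ _ _ → At-≈-refl ss)

    At-≈-refl : ∀ ss → At ss i a → At ss i b → a ≈ b
    At-≈-refl (s ∷ _)  here      here      = ≈-refl s
    At-≈-refl (_ ∷ ss) (there p) (there q) = At-≈-refl ss p q

  ≈-sym : s ≈ t → t ≈ s
  ≈-sym (eq-mono len args) = eq-mono (sym len) (λ i a b p q → ≈-sym (args i b a q p))
  ≈-sym (eq-args eq f≃g sf len args) =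
    eq-args (sym eq) (≃ₚ-sym f≃g) (sym ∘ sf) (sym len)
            (λ i a b m p q → ≈-sym (args i b a (subst T (sym (sf i)) m) q p))

  ≈-trans : s ≈ t → t ≈ u → s ≈ u
  ≈-trans (eq-mono len args) (eq-mono len′ args′) =
    eq-mono (trans len len′) λ i a c p r →
      let b , q = At-align len p in ≈-trans (args i a b p q) (args′ i b c q r)
  ≈-trans (eq-args eq f≃g sf len args) (eq-args eq′ g≃h sf′ len′ args′) =
    eq-args (trans eq eq′) (≃ₚ-trans f≃g g≃h) (λ i → trans (sf i) (sf′ i)) (trans len len′)
      λ i a c m p r → let b , q = At-align len p
                      in ≈-trans (args i a b m p q) (args′ i b c (subst T (sf i) m) q r)

  Closed-cong : fun f ss ≈ fun g ts → Closed g (length ts) → Closed f (length ss)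
  Closed-cong (eq-args eq _ sf len _) cl i n<i i≤m =
    subst T (sym (sf i)) (cl i (subst (_< i) len n<i) (subst (λ σ → i ≤ arity σ) eq i≤m))

  Closed-∷ʳ : ∀ ss → Closed f (length ss) → Closed f (length (ss ++ [ u ]))
  Closed-∷ʳ ss cl i n<i = cl i (≤-trans (n≤1+n _) (subst (_< i) (length-∷ʳ ss) n<i))

  ⊐⊐-closed : fun f ss ⊐⊐ t → Closed f (length ss)
  ⊐⊐-closed (rpo-select cl _)                 = cl
  ⊐⊐-closed (rpo-appl cl _ _ _ _ _ _)         = cl
  ⊐⊐-closed (rpo-copy cl _ _)                 = cl
  ⊐⊐-closed (rpo-lex cl _ _ _ _ _ _ _ _ _ _ _ _) = cl

  mutual
    ≈-⊐-trans : ∃ (WT s) → s ≈ t → t ⊐ u → s ⊐ u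
    ≈-⊐-trans (_ , var ws) (eq-mono len args) (gr-mono len′ args′ (i , b , c , q , r , b⊐c)) =
      gr-mono (trans len len′)
        (λ i a c p r → let b , q = At-align len p
                       in ≈-⊒-trans (WTArgs-At ws p) (args i a b p q) (args′ i b c q r))
        (let a , p = At-align (sym len) q
         in i , a , c , p , r , ≈-⊐-trans (WTArgs-At ws p) (args i a b p q) b⊐c)
    ≈-⊐-trans (_ , fun ws) (eq-args eq f≃g sf len args)
              (gr-args eq′ g≃h sf′ len′ args′ (i , b , c , m , q , r , b⊐c)) =
      gr-args (trans eq eq′) (≃ₚ-trans f≃g g≃h) (λ i → trans (sf i) (sf′ i)) (trans len len′)
        (λ i a c m p r → let b , q = At-align len p
                         in ≈-⊒-trans (WTArgs-At ws p) (args i a b m p q) (args′ i b c (subst T (sf i) m) q r))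
        (let a , p = At-align (sym len) q
             m′ = subst T (sym (sf i)) m
         in i , a , c , m′ , p , r , ≈-⊐-trans (WTArgs-At ws p) (args i a b m′ p q) b⊐c)
    ≈-⊐-trans (_ , ws) s≈t (gr-rpo (_ , wt , wu) t⊐⊐u) =
      gr-rpo (_ , subst (WT _) (≈-type s≈t ws wt) ws , wu) (≈-⊐⊐-trans (_ , ws) s≈t t⊐⊐u)

    ≈-⊒-trans : ∃ (WT s) → s ≈ t → t ⊒ u → s ⊒ u
    ≈-⊒-trans _  s≈t (≈⇒⊒ t≈u) = ≈⇒⊒ (≈-trans s≈t t≈u)
    ≈-⊒-trans ws s≈t (⊐⇒⊒ t⊐u) = ⊐⇒⊒ (≈-⊐-trans ws s≈t t⊐u)

    ≈-⊐⊐-trans : ∃ (WT s) → s ≈ t → t ⊐⊐ u → s ⊐⊐ u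
    ≈-⊐⊐-trans (_ , fun ws) s≈t@(eq-args _ _ sf len args) (rpo-select cl (i , b , m , q , b⊒u)) =
      let m′ = subst T (sym (sf i)) m
          a , p = At-align (sym len) q
      in rpo-select (Closed-cong s≈t cl)
           (i , a , m′ , p , ≈-⊒-trans (WTArgs-At ws p) (args i a b m′ p q) b⊒u)
    ≈-⊐⊐-trans ws s≈t@(eq-args _ _ _ _ _) (rpo-appl cl t₀ v vs refl d₀ ds) =
      rpo-appl (Closed-cong s≈t cl) t₀ v vs refl (≈-⊐⊐-trans ws s≈t d₀) (≈-⊐⊐-trans-All ws s≈t ds)
    ≈-⊐⊐-trans ws s≈t@(eq-args _ f≃g _ _ _) (rpo-copy cl g▷h below) =
      rpo-copy (Closed-cong s≈t cl) (≃ₚ-▷-trans f≃g g▷h)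
        (λ i b m q → ≈-⊐⊐-trans ws s≈t (below i b m q))
    ≈-⊐⊐-trans ws@(_ , fun ws′) s≈t@(eq-args _ f≃g sf len args)
               (rpo-lex cl g≃h i b c mg mh q r agree prefix b⊐c after) =
      let mf = subst T (sym (sf i)) mg
          a , p = At-align (sym len) q
      in rpo-lex (Closed-cong s≈t cl) (≃ₚ-trans f≃g g≃h) i a c mf mh p r
           (λ j j≤i → trans (sf j) (agree j j≤i))
           (λ j a′ c′ j<i mj p′ r′ →
              let b′ , q′ = At-align len p′
              in ≈-trans (args j a′ b′ mj p′ q′) (prefix j b′ c′ j<i (subst T (sf j) mj) q′ r′))
           (≈-⊐-trans (WTArgs-At ws′ p) (args i a b mf p q) b⊐c)
           (λ j c′ i<j m r′ → ≈-⊐⊐-trans ws s≈t (after j c′ i<j m r′))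
    ≈-⊐⊐-trans _ (eq-mono _ _) ()

    ≈-⊐⊐-trans-All : ∃ (WT s) → s ≈ t → All (t ⊐⊐_) us → All (s ⊐⊐_) us
    ≈-⊐⊐-trans-All _  _   []       = []
    ≈-⊐⊐-trans-All ws s≈t (d ∷ ds) = ≈-⊐⊐-trans ws s≈t d ∷ ≈-⊐⊐-trans-All ws s≈t ds

  mutual
    ⊐⊐-∷ʳ : fun f ss ⊐⊐ t → fun f (ss ++ [ u ]) ⊐⊐ t
    ⊐⊐-∷ʳ {ss = ss} (rpo-select cl (i , a , m , p , a⊒t)) =
      rpo-select (Closed-∷ʳ ss cl) (i , a , m , At-++⁺ˡ p , a⊒t)
    ⊐⊐-∷ʳ {ss = ss} (rpo-appl cl t₀ v vs eq d₀ ds) =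
      rpo-appl (Closed-∷ʳ ss cl) t₀ v vs eq (⊐⊐-∷ʳ d₀) (⊐⊐-∷ʳ-All ds)
    ⊐⊐-∷ʳ {ss = ss} (rpo-copy cl f▷g below) =
      rpo-copy (Closed-∷ʳ ss cl) f▷g (λ i b m q → ⊐⊐-∷ʳ (below i b m q))
    ⊐⊐-∷ʳ {ss = ss} (rpo-lex cl f≃g i a b mf mg p q agree prefix a⊐b after) =
      rpo-lex (Closed-∷ʳ ss cl) f≃g i a b mf mg (At-++⁺ˡ p) q agree
        (λ j a′ b′ j<i m p′ q′ →
           prefix j a′ b′ j<i m (At-++⁻ˡ ss p′ (≤-trans (<⇒≤ j<i) (At-length p))) q′)
        a⊐b (λ j b′ i<j m q′ → ⊐⊐-∷ʳ (after j b′ i<j m q′))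

    ⊐⊐-∷ʳ-All : All (fun f ss ⊐⊐_) us → All (fun f (ss ++ [ u ]) ⊐⊐_) us
    ⊐⊐-∷ʳ-All []       = []
    ⊐⊐-∷ʳ-All (d ∷ ds) = ⊐⊐-∷ʳ d ∷ ⊐⊐-∷ʳ-All ds

  app-congˡ : s ≈ t → app s u ≈ app t u
  app-congˡ {u = u} (eq-mono {ss = ss} {ts = ts} len args) =
    eq-mono (length-∷ʳ-cong ss ts len) (λ i a b → At-∷ʳ-elim len (args i _ _) (≈-refl u))
  app-congˡ {u = u} (eq-args {ss = ss} {ts = ts} eq f≃g sf len args) =
    eq-args eq f≃g sf (length-∷ʳ-cong ss ts len) (λ i a b m → At-∷ʳ-elim len (args i _ _ m) (≈-refl u))

  app-monoˡ-⊐ : WT u ρ → WT s (ρ ⇒ τ) → s ⊐ t → app s u ⊐ app t u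
  app-monoˡ-⊐ {u = u} _ _ (gr-mono {ss = ss} {ts = ts} len args (i , a , b , p , q , a⊐b)) =
    gr-mono (length-∷ʳ-cong ss ts len) (λ i a b → At-∷ʳ-elim len (args i _ _) (≈⇒⊒ (≈-refl u)))
      (i , a , b , At-++⁺ˡ p , At-++⁺ˡ q , a⊐b)
  app-monoˡ-⊐ {u = u} _ _ (gr-args {ss = ss} {ts = ts} eq f≃g sf len args (i , a , b , m , p , q , a⊐b)) =
    gr-args eq f≃g sf (length-∷ʳ-cong ss ts len)
      (λ i a b m → At-∷ʳ-elim len (args i _ _ m) (≈⇒⊒ (≈-refl u)))
      (i , a , b , m , At-++⁺ˡ p , At-++⁺ˡ q , a⊐b)
  app-monoˡ-⊐ {u = u} wu ws@(fun {f = f} {ss = ss} ws′) (gr-rpo {t = t} (_ , ws″ , wt) s⊐⊐t) =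
    gr-rpo (_ , WT-app ws wu , WT-app (subst (WT t) (WT-unique ws″ ws) wt) wu)
      (rpo-appl cl′ t u [] refl (⊐⊐-∷ʳ s⊐⊐t) (select-u ∷ []))
    where
    cl′ : Closed f (length (ss ++ [ u ]))
    cl′ = Closed-∷ʳ ss (⊐⊐-closed s⊐⊐t)
    -- u is the (n+1)-th argument of f s₁ ⋯ sₙ u, which the side condition {n+1,…,m} ⊆ π(f)
    -- puts in the filter.
    select-u : fun f (ss ++ [ u ]) ⊐⊐ u
    select-u = rpo-select cl′
      ( suc (length ss) , u
      , ⊐⊐-closed s⊐⊐t (suc (length ss)) ≤-refl
          (subst (_≤ _) (length-∷ʳ ss) (WTArgs-length (WTArgs-∷ʳ ws′ wu)))
      , At-∷ʳ-last ss , ≈⇒⊒ (≈-refl u))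
  app-monoˡ-⊐ _ (var _) (gr-rpo _ ())

  app-monoˡ-⊒ : WT u ρ → WT s (ρ ⇒ τ) → s ⊒ t → app s u ⊒ app t u
  app-monoˡ-⊒ _  _  (≈⇒⊒ s≈t) = ≈⇒⊒ (app-congˡ s≈t)
  app-monoˡ-⊒ wu ws (⊐⇒⊒ s⊐t) = ⊐⇒⊒ (app-monoˡ-⊐ wu ws s⊐t)

  _⊏_ : Tm → Tm → Set
  t ⊏ s = s ⊐ t × SameTy s t

  SN : Tm → Set
  SN = Acc _⊏_

  ⊐⇒⊏ : s ⊐ t → WT s σ → WT t τ → t ⊏ s
  ⊐⇒⊏ s⊐t ws wt = s⊐t , _ , ws , subst (WT _) (sym (⊐-type s⊐t ws wt)) wt

  ⊏-WT : t ⊏ s → WT s σ → WT t σ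
  ⊏-WT (_ , _ , ws′ , wt) ws = subst (WT _) (WT-unique ws′ ws) wt

  SN-⊒ : SN s → WT s σ → WT t σ → s ⊒ t → SN t
  SN-⊒ (acc below) ws wt (≈⇒⊒ s≈t) =
    acc λ u⊏t@(t⊐u , _) → below (≈-⊐-trans (_ , ws) s≈t t⊐u , _ , ws , ⊏-WT u⊏t wt)
  SN-⊒ (acc below) ws wt (⊐⇒⊒ s⊐t) = below (s⊐t , _ , ws , wt)

  SN-app⁻ : SN (app s u) → WT s (ρ ⇒ τ) → WT u ρ → SN s
  SN-app⁻ (acc below) ws wu = acc λ t⊏s@(s⊐t , _) →
    let wt = ⊏-WT t⊏s ws
    in SN-app⁻ (below (⊐⇒⊏ (app-monoˡ-⊐ wu ws s⊐t) (WT-app ws wu) (WT-app wt wu))) wt wu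

  Comp : Ty → Tm → Set
  Comp ι       s = SN s
  Comp (σ ⇒ τ) s = ∀ u → WT u σ → Comp σ u → Comp τ (app s u)

  Comp-⊒ : ∀ σ → Comp σ s → WT s σ → WT t σ → s ⊒ t → Comp σ t
  Comp-⊒ ι       = SN-⊒
  Comp-⊒ (ρ ⇒ τ) c ws wt s⊒t u wu cu =
    Comp-⊒ τ (c u wu cu) (WT-app ws wu) (WT-app wt wu) (app-monoˡ-⊒ wu ws s⊒t)

  Computable : Tm → Set
  Computable a = ∃[ σ ] WT a σ × Comp σ a

  Computable-⊒ : Computable a → ∃ (WT b) → a ⊒ b → Computable b
  Computable-⊒ (σ , wa , c) (_ , wb) a⊒b with ⊒-type a⊒b wa wb
  ... | refl = σ , wb , Comp-⊒ σ c wa wb a⊒b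

  Computable⇒Comp : Computable a → WT a τ → Comp τ a
  Computable⇒Comp (_ , wa , c) wa′ = subst (λ τ → Comp τ _) (WT-unique wa wa′) c

  TypedSN : Tm → Set
  TypedSN a = ∃ (WT a) × SN a

  SNTerm : Set
  SNTerm = Σ Tm TypedSN

  _≈ˢ_ _⊏ˢ_ : SNTerm → SNTerm → Set
  _≈ˢ_ = _≈_ on proj₁
  _⊏ˢ_ = flip _⊐_ on proj₁

  SN⇒Acc-⊏ˢ : SN a → WT a σ → ∀ {p} → Acc _⊏ˢ_ (a , p)
  SN⇒Acc-⊏ˢ (acc below) wa = acc λ {(_ , (_ , wb) , _)} a⊐b → SN⇒Acc-⊏ˢ (below (⊐⇒⊏ a⊐b wa wb)) wb

  ⊏ˢ-wellFounded : WellFounded _⊏ˢ_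
  ⊏ˢ-wellFounded (_ , (_ , wa) , sn) = SN⇒Acc-⊏ˢ sn wa

  ⊏ˢ-respʳ-≈ˢ : _⊏ˢ_ Respectsʳ _≈ˢ_
  ⊏ˢ-respʳ-≈ˢ {y = _ , wb′ , _} b≈b′ b⊐a = ≈-⊐-trans wb′ (≈-sym b≈b′) b⊐a

  _<ₗₑₓ_ : ∀ {n} → Vec SNTerm n → Vec SNTerm n → Set
  _<ₗₑₓ_ = Lex-< _≈ˢ_ _⊏ˢ_

  <ₗₑₓ-wellFounded : ∀ {n} → WellFounded (_<ₗₑₓ_ {n})
  -- _⊏ˢ_ only sees first components, so the implicit arguments cannot be inferred.
  <ₗₑₓ-wellFounded = <-wellFounded ≈-trans (λ {x} {y} {z} → ⊏ˢ-respʳ-≈ˢ {x} {y} {z}) ⊏ˢ-wellFounded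

  -- Positions outside the filter F and positions past the last argument are padded with the
  -- ⊐-minimal term ⋆, so that argument lists of different lengths become vectors of one length.
  ⋆ : Tm
  ⋆ = var ι 0 []

  ⋆-SN : SN ⋆
  ⋆-SN = acc λ { (gr-mono _ _ (_ , _ , _ , () , _) , _) ; (gr-rpo _ () , _) }

  ⋆ˢ : SNTerm
  ⋆ˢ = ⋆ , (ι , var []) , ⋆-SN

  slot : (c : Bool) (a : Tm) → (T c → TypedSN a) → SNTerm
  slot true  a sn = a , sn tt
  slot false _ _  = ⋆ˢ

  SNArgs : (ℕ → Bool) → List Tm → Set
  SNArgs F ss = ∀ {i a} → T (F i) → At ss i a → TypedSN a

  filtered : ∀ F ss → SNArgs F ss → (n : ℕ) → Vec SNTerm n
  filtered F ss       sn zero    = []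
  filtered F []       sn (suc n) = ⋆ˢ ∷ filtered (F ∘ suc) [] (λ _ ()) n
  filtered F (s ∷ ss) sn (suc n) =
    slot (F 1) s (λ m → sn m here) ∷ filtered (F ∘ suc) ss (λ m p → sn m (there p)) n

  -- The common shape of Gr-args and Rpo-lex steps.
  data LexDecrease (F G : ℕ → Bool) (ss ts : List Tm) : Set where
    lexDecrease : ∀ i → T (F i) → At ss i a → At ts i b → a ⊐ b →
                  (∀ j → j ≤ i → F j ≡ G j) →
                  (∀ j a′ b′ → j < i → T (F j) → At ss j a′ → At ts j b′ → a′ ⊒ b′) →
                  LexDecrease F G ss ts

  slot-⊏ˢ : ∀ {c d sa sb} → c ≡ d → T c → a ⊐ b → slot d b sb ⊏ˢ slot c a sa
  slot-⊏ˢ {c = true} refl _ a⊐b = a⊐b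

  slot-⊑ˢ : ∀ {c d sa sb} → c ≡ d → (T c → a ⊒ b) →
            slot d b sb ≈ˢ slot c a sa ⊎ slot d b sb ⊏ˢ slot c a sa
  slot-⊑ˢ {c = false} refl _ = inj₁ (≈-refl ⋆)
  slot-⊑ˢ {c = true}  refl a⊒b with a⊒b tt
  ... | ≈⇒⊒ a≈b = inj₁ (≈-sym a≈b)
  ... | ⊐⇒⊒ a⊐b = inj₂ a⊐b

  LexDecrease⇒<ₗₑₓ : ∀ {F G ss ts n} {sn : SNArgs F ss} {sn′ : SNArgs G ts} →
                     LexDecrease F G ss ts → length ss ≤ n → filtered G ts sn′ n <ₗₑₓ filtered F ss sn n
  LexDecrease⇒<ₗₑₓ (lexDecrease _ m here here a⊐b agree _) (s≤s _) =
    this (slot-⊏ˢ (agree 1 ≤-refl) m a⊐b) refl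
  LexDecrease⇒<ₗₑₓ (lexDecrease (suc i) m (there p) (there q) a⊐b agree prefix) (s≤s len)
    with slot-⊑ˢ (agree 1 (s≤s z≤n)) (λ m₁ → prefix 1 _ _ (s≤s (At-positive p)) m₁ here here)
  ... | inj₁ head≈ =
    let tail = lexDecrease i m p q a⊐b (λ j j≤i → agree (suc j) (s≤s j≤i))
                 (λ j a′ b′ j<i mj p′ q′ → prefix (suc j) a′ b′ (s≤s j<i) mj (there p′) (there q′))
    in next head≈ (LexDecrease⇒<ₗₑₓ tail len)
  ... | inj₂ head⊏ = this head⊏ refl

  TypedSN-⊒ : TypedSN a → ∃ (WT b) → a ⊒ b → TypedSN b
  TypedSN-⊒ ((_ , wa) , sn) (_ , wb) a⊒b with ⊒-type a⊒b wa wb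
  ... | refl = (_ , wb) , SN-⊒ sn wa wb a⊒b

  var-SN : ∀ {x n} → WT (var σ x ss) τ → (sn : SNArgs (const true) ss) → length ss ≤ n →
           Acc _<ₗₑₓ_ (filtered (const true) ss sn n) → SN (var σ x ss)
  var-SN (var ws) sn len (acc smaller) = acc λ where
    (gr-mono same ⊒s (i , a , b , p , q , a⊐b) , _ , _ , var wts) →
      let sn′ : SNArgs (const true) _
          sn′ _ q′ = let a′ , p′ = At-align (sym same) q′
                     in TypedSN-⊒ (sn _ p′) (WTArgs-At wts q′) (⊒s _ a′ _ p′ q′)
          decrease = lexDecrease i tt p q a⊐b (λ _ _ → refl) (λ j a′ b′ _ _ → ⊒s j a′ b′)
      in var-SN (var wts) sn′ (subst (_≤ _) same len) (smaller (LexDecrease⇒<ₗₑₓ decrease len))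
    (gr-rpo _ () , _)

  mutual
    Comp⇒SN : ∀ σ → Comp σ s → WT s σ → SN s
    Comp⇒SN ι       c _  = c
    Comp⇒SN (ρ ⇒ τ) c ws =
      SN-app⁻ (Comp⇒SN τ (c x wx (var-Comp ρ wx (λ _ ()))) (WT-app ws wx)) ws wx
      where
      x : Tm
      x = var ρ 0 []
      wx : WT x ρ
      wx = var []

    var-Comp : ∀ τ {x} → WT (var σ x ss) τ → SNArgs (const true) ss → Comp τ (var σ x ss)
    var-Comp ι       w  sn = var-SN w sn ≤-refl (<ₗₑₓ-wellFounded _)
    var-Comp {ss = ss} (ρ ⇒ τ) (var ws) sn u wu cu = var-Comp τ (var (WTArgs-∷ʳ ws wu)) sn′
      where
      sn′ : SNArgs (const true) (ss ++ [ u ])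
      sn′ _ p with At-∷ʳ⁻ ss p
      ... | inj₁ p′   = sn _ p′
      ... | inj₂ refl = (ρ , wu) , Comp⇒SN ρ cu wu

  Computable⇒TypedSN : Computable a → TypedSN a
  Computable⇒TypedSN (σ , wa , c) = (σ , wa) , Comp⇒SN σ c wa

  CompArgs : Sym → List Tm → Set
  CompArgs f ss = ∀ i a → i ∈π f → At ss i a → Computable a

  CompArgs-∷ʳ : CompArgs g ts → WT u ρ → Comp ρ u → CompArgs g (ts ++ [ u ])
  CompArgs-∷ʳ {ts = ts} ca wu cu i a m p with At-∷ʳ⁻ ts p
  ... | inj₁ p′   = ca i a m p′
  ... | inj₂ refl = _ , wu , cu

  CompArgs-⊒ : CompArgs f ss → SameFilter f g → length ss ≡ length ts →
               (∀ i a b → i ∈π f → At ss i a → At ts i b → a ⊒ b) → WT (fun g ts) τ → CompArgs g ts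
  CompArgs-⊒ ca sf same ⊒s wt j b m q =
    let a , p = At-align (sym same) q
        m′ = subst T (sym (sf j)) m
    in Computable-⊒ (ca j a m′ p) (WT-fun-At wt q) (⊒s j a b m′ p q)

  filteredArgs : ∀ f ss → CompArgs f ss → (n : ℕ) → Vec SNTerm n
  filteredArgs f ss ca = filtered (π f) ss (λ m p → Computable⇒TypedSN (ca _ _ m p))

  data _≺ₕ_ : Sym × List Tm → Sym × List Tm → Set where
    copy : f ▷ g → (g , ts) ≺ₕ (f , ss)
    lex  : f ≃ₚ g → LexDecrease (π f) (π g) ss ts → (g , ts) ≺ₕ (f , ss)

  ≺ₕ-∷ʳ : (g , ts) ≺ₕ (f , ss) → (g , ts ++ [ u ]) ≺ₕ (f , ss)
  ≺ₕ-∷ʳ (copy f▷g) = copy f▷g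
  ≺ₕ-∷ʳ (lex f≃g (lexDecrease i m p q a⊐b agree prefix)) =
    lex f≃g (lexDecrease i m p (At-++⁺ˡ q) a⊐b agree λ j a′ b′ j<i mj p′ q′ →
      prefix j a′ b′ j<i mj p′ (At-++⁻ˡ _ q′ (≤-trans (<⇒≤ j<i) (At-length q))))

  FullApp : Sym × List Tm → Set
  FullApp (f , ss) = WT (fun f ss) ι × CompArgs f ss

  _≺_ : Sym × List Tm → Sym × List Tm → Set
  y ≺ x = y ≺ₕ x × FullApp y

  arityBound : Sym → ℕ
  arityBound f = proj₁ (≃ₚ-arity-bounded f)

  length≤arityBound : f ≃ₚ g → WT (fun f ss) τ → length ss ≤ arityBound g
  length≤arityBound f≃g (fun ws) = ≤-trans (WTArgs-length ws) (proj₂ (≃ₚ-arity-bounded _) _ f≃g)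

  ≺-accessible : ∀ f ss → FullApp (f , ss) → Acc _≺_ (f , ss)
  ≺-accessible f ss fa = above (▷-wellFounded f) ≃ₚ-refl fa (<ₗₑₓ-wellFounded _)
    where
    -- Induction on the precedence of a fixed representative f₀ of the ≃ₚ-class, and inside it on
    -- the filtered arguments padded to the arity bound of that class.
    above : ∀ {f₀ f ss} → Acc (λ g f → f ▷ g) f₀ → f ≃ₚ f₀ → ((_ , ca) : FullApp (f , ss)) →
            Acc _<ₗₑₓ_ (filteredArgs f ss ca (arityBound f₀)) → Acc _≺_ (f , ss)
    above {f₀} (acc lower) = within
      where
      within : ∀ {f ss} → f ≃ₚ f₀ → ((_ , ca) : FullApp (f , ss)) →
               Acc _<ₗₑₓ_ (filteredArgs f ss ca (arityBound f₀)) → Acc _≺_ (f , ss)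
      within f≃f₀ (w , _) (acc smaller) = acc λ where
        (copy f▷g , ga) →
          above (lower (≃ₚ-▷-trans (≃ₚ-sym f≃f₀) f▷g)) ≃ₚ-refl ga (<ₗₑₓ-wellFounded _)
        (lex f≃g d , ga) →
          within (≃ₚ-trans (≃ₚ-sym f≃g) f≃f₀) ga
            (smaller (LexDecrease⇒<ₗₑₓ d (length≤arityBound f≃f₀ w)))

  module _ (P : List Tm → Set) (P-∷ʳ : ∀ {ts u} → P ts → P (ts ++ [ u ])) where
    Comp-fun-intro : ∀ τ → P ts → WT (fun g ts) τ → CompArgs g ts →
                     (∀ {ts′} → P ts′ → WT (fun g ts′) ι → CompArgs g ts′ → SN (fun g ts′)) →
                     Comp τ (fun g ts)
    Comp-fun-intro ι       p w ca sn = sn p w ca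
    Comp-fun-intro (ρ ⇒ τ) p w ca sn u wu cu =
      Comp-fun-intro τ (P-∷ʳ p) (WT-app w wu) (CompArgs-∷ʳ ca wu cu) sn

  Comp-apps : Comp σ t → WT t σ → WTArgs σ us τ → All (λ u → ∀ {ρ} → WT u ρ → Comp ρ u) us →
              Comp τ (apps t us)
  Comp-apps c _  []         []         = c
  Comp-apps c wt (wu ∷ wus) (cu ∷ cus) = Comp-apps (c _ wu (cu wu)) (WT-app wt wu) wus cus

  module _ {f ss} (ca : CompArgs f ss)
           (ih : ∀ {g ts} → (g , ts) ≺ₕ (f , ss) → WT (fun g ts) ι → CompArgs g ts → SN (fun g ts)) where
    mutual
      ⊐⊐-Comp : fun f ss ⊐⊐ t → WT t τ → Comp τ t
      ⊐⊐-Comp (rpo-select _ (i , a , m , p , a⊒t)) wt =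
        Computable⇒Comp (Computable-⊒ (ca i a m p) (_ , wt) a⊒t) wt
      ⊐⊐-Comp (rpo-appl _ t₀ u us refl d₀ ds) wt =
        let _ , wt₀ , wus = WT-apps⁻ t₀ (u ∷ us) wt
        in Comp-apps (⊐⊐-Comp d₀ wt₀) wt₀ wus (⊐⊐-Comp-All ds)
      ⊐⊐-Comp (rpo-copy _ f▷g below) wt =
        Comp-fun-intro _ ≺ₕ-∷ʳ _ (copy f▷g) wt
          (λ j b m q → let _ , wb = WT-fun-At wt q in _ , wb , ⊐⊐-Comp (below j b m q) wb) ih
      ⊐⊐-Comp {t = fun g ts} (rpo-lex _ f≃g i a b m _ p q agree prefix a⊐b after) wt =
        Comp-fun-intro _ ≺ₕ-∷ʳ _ (lex f≃g decrease) wt args ih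
        where
        decrease : LexDecrease (π f) (π g) ss ts
        decrease = lexDecrease i m p q a⊐b agree
                     λ j a′ b′ j<i mj p′ q′ → ≈⇒⊒ (prefix j a′ b′ j<i mj p′ q′)
        args : CompArgs g ts
        args j b′ mj q′ with <-cmp j i
        ... | tri< j<i _ _ =
          let mf = subst T (sym (agree j (<⇒≤ j<i))) mj
              a′ , p′ = At-transport (≤-trans (<⇒≤ j<i) (At-length p)) q′
          in Computable-⊒ (ca j a′ mf p′) (WT-fun-At wt q′) (≈⇒⊒ (prefix j a′ b′ j<i mf p′ q′))
        ... | tri≈ _ refl _ rewrite At-unique q′ q =
          Computable-⊒ (ca i a m p) (WT-fun-At wt q) (⊐⇒⊒ a⊐b)
        ... | tri> _ _ i<j =
          let _ , wb = WT-fun-At wt q′ in _ , wb , ⊐⊐-Comp (after j b′ i<j mj q′) wb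

      ⊐⊐-Comp-All : All (fun f ss ⊐⊐_) us → All (λ u → ∀ {ρ} → WT u ρ → Comp ρ u) us
      ⊐⊐-Comp-All []       = []
      ⊐⊐-Comp-All (d ∷ ds) = ⊐⊐-Comp d ∷ ⊐⊐-Comp-All ds

  fun-SN : Acc _≺_ (f , ss) → WT (fun f ss) ι → CompArgs f ss → SN (fun f ss)
  fun-SN (acc smaller) w ca = acc λ where
    t⊏s@(gr-args _ f≃g sf same ⊒s (i , a , b , m , p , q , a⊐b) , _) →
      let wt = ⊏-WT t⊏s w
          cat = CompArgs-⊒ ca sf same ⊒s wt
          decrease = lexDecrease i m p q a⊐b (λ j _ → sf j) (λ j a′ b′ _ → ⊒s j a′ b′)
      in fun-SN (smaller (lex f≃g decrease , wt , cat)) wt cat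
    t⊏s@(gr-rpo _ s⊐⊐t , _) →
      ⊐⊐-Comp ca (λ g≺f wg cag → fun-SN (smaller (g≺f , wg , cag)) wg cag) s⊐⊐t (⊏-WT t⊏s w)

  mutual
    Comp-all : WT s σ → Comp σ s
    Comp-all w@(var ws) = var-Comp _ w (λ _ p → Computable⇒TypedSN (WTArgs-Computable ws p))
    Comp-all w@(fun ws) =
      Comp-fun-intro (λ _ → ⊤) (λ _ → tt) _ tt w (λ _ _ _ p → WTArgs-Computable ws p)
        (λ _ w′ ca → fun-SN (≺-accessible _ _ (w′ , ca)) w′ ca)

    WTArgs-Computable : WTArgs σ ss τ → At ss i a → Computable a
    WTArgs-Computable (w ∷ _)  here      = _ , w , Comp-all w
    WTArgs-Computable (_ ∷ ws) (there p) = WTArgs-Computable ws p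

  WT⇒SN : WT s σ → SN s
  WT⇒SN w = Comp⇒SN _ (Comp-all w) w

  no-infinite-descent : ¬ InfiniteDescent
  no-infinite-descent (s , typed , descends) = along 0 (WT⇒SN (proj₂ (typed 0)))
    where
    along : ∀ n → SN (s n) → ⊥
    along n (acc below) =
      along (suc n) (below (⊐⇒⊏ (descends n) (proj₂ (typed n)) (proj₂ (typed (suc n)))))

corollary12 : (Sym : Set) (typ : Sym → Ty) (_⊵_ : Sym → Sym → Set) (π : Sym → ℕ → Bool) →
    IsPreorder _≡_ _⊵_ →
    WellFounded (λ g f → RPO._▷_ Sym typ _⊵_ π f g) →
    (∀ f i → RPO._∈π_ Sym typ _⊵_ π i f → 1 ≤ i × i ≤ arity (typ f)) →
    (∀ f → ∃[ B ] (∀ g → RPO._≃ₚ_ Sym typ _⊵_ π g f → arity (typ g) ≤ B)) →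
    ¬ RPO.InfiniteDescent Sym typ _⊵_ π
corollary12 Sym typ _⊵_ π ⊵-isPreorder ▷-wellFounded _ ≃ₚ-arity-bounded =
  Termination.no-infinite-descent Sym typ _⊵_ π ⊵-isPreorder ▷-wellFounded ≃ₚ-arity-bounded
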